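{- For every integer $n\geq 2$, the number of permutations $\pi\in\mathcal{S}_n$ such that $\pi$ avoids both patterns $213$ and $312$ and $\pi^2$ avoids the consecutive pattern $\overline{213}$ equals $2^{n-2}+n-1$.
   Context: $\mathcal{S}_n$ is the set of permutations of $[n]$, written as words $\pi=\pi_1\cdots\pi_n$ with $\pi_i=\pi(i)$; $\pi^2=\pi\circ\pi$. A permutation $\pi$ contains a pattern $\sigma\in\mathcal{S}_k$ if some subsequence $\pi_{i_1}\cdots\pi_{i_k}$ ($i_1<\dots<i_k$) is order isomorphic to $\sigma$; otherwise it avoids $\sigma$. A permutation $\pi$ contains the consecutive pattern $\overline{213}$ if there is an index $i$ with $\pi_{i+1}<\pi_i<\pi_{i+2}$ (i.e. three consecutive entries order isomorphic to $213$); otherwise it avoids $\overline{213}$. -}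

module Defs where

open import Data.Nat using (ℕ; _<_)
open import Data.Fin using (Fin; toℕ)
open import Data.Fin.Properties using ()
open import Data.Vec using (Vec; lookup)
open import Data.List using (List; length)
open import Data.List.Membership.Propositional using (_∈_)
open import Data.List.Relation.Unary.Unique.Propositional using (Unique)
open import Data.Product using (∃; ∃-syntax; _×_)
open import Relation.Nullary using (¬_)
open import Relation.Binary.PropositionalEquality using (_≡_)
open import Function.Bundles using (_⇔_)

-- A permutation of [n] written as a word π = π₁ ⋯ πₙ over the alphabet Fin n
-- (Fin n stands for [n] = {1,…,n}, shifted down by one; order is preserved).
Word : ℕ → Set
Word n = Vec (Fin n) n

IsPerm : ∀ {n} → Word n → Set
IsPerm {n} π = ∀ (i j : Fin n) → lookup π i ≡ lookup π j → i ≡ j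

_<ᶠ_ : ∀ {n} → Fin n → Fin n → Set
a <ᶠ b = toℕ a < toℕ b

square : ∀ {n} → Word n → Word n
square π = Data.Vec.tabulate (λ i → lookup π (lookup π i))

Contains213 : ∀ {n} → Word n → Set
Contains213 {n} π = ∃[ i ] ∃[ j ] ∃[ k ]
  (i <ᶠ j × j <ᶠ k × lookup π j <ᶠ lookup π i × lookup π i <ᶠ lookup π k)

Contains312 : ∀ {n} → Word n → Set
Contains312 {n} π = ∃[ i ] ∃[ j ] ∃[ k ]
  (i <ᶠ j × j <ᶠ k × lookup π j <ᶠ lookup π k × lookup π k <ᶠ lookup π i)

ContainsConsec213 : ∀ {n} → Word n → Set
ContainsConsec213 {n} π = ∃[ i ] ∃[ j ] ∃[ k ]
  (toℕ j ≡ Data.Nat.suc (toℕ i) × toℕ k ≡ Data.Nat.suc (toℕ j) ×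
   lookup π j <ᶠ lookup π i × lookup π i <ᶠ lookup π k)

Good : ∀ {n} → Word n → Set
Good π = IsPerm π × ¬ Contains213 π × ¬ Contains312 π × ¬ ContainsConsec213 (square π)

HasCount : ∀ {n} → (Word n → Set) → ℕ → Set
HasCount {n} P m = ∃[ xs ] (Unique xs × (∀ (w : Word n) → (w ∈ xs ⇔ P w)) × length xs ≡ m)

-- A permutation avoids 213 and 312 iff no entry is smaller than an entry on each side of
-- it, i.e. iff it is unimodal.  Its smallest value then sits at one end, so removing it
-- recursively shows that these permutations of {0,…,k} correspond to codes w ∈ {L,R}^k
-- saying at which end (L = true) each of 0,…,k−1 is placed; the maximum k sits at the
-- peak p = #L.  If π² had a consecutive 213 at i, i+1, i+2 with i+1 ≠ p, then π would be
-- monotone on these positions and π would contain 213 or 312 at the entries π(i), π(i+1),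
-- π(i+2); so i+1 = p, and a case analysis around the peak shows that such an occurrence
-- exists iff p ≤ k−2 and the last letter, which places k−1 next to the peak, is L.  The good
-- codes are the 2^(k−1) ending in R, plus the all-L code and the k−1 codes with a single R
-- among the first k−1 letters: 2^(n−2) + n − 1 for n = k + 1.

module Submission where

open import Defs
open import Data.Bool using (Bool; true; false)
open import Data.Empty using (⊥; ⊥-elim)
open import Data.Fin using (Fin; toℕ; fromℕ<; punchOut)
open import Data.Fin.Properties
  using (toℕ<n; toℕ≤pred[n]; toℕ-fromℕ<; fromℕ<-toℕ; toℕ-injective; punchOut-injective; any?; injective⇒≤)
  renaming (_≟_ to _≟ᶠ_)
open import Data.List using (List; []; _∷_; map; _++_; length)
open import Data.List.Properties using (length-map; length-++)
open import Data.List.Membership.Propositional using (_∈_)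
open import Data.List.Membership.Propositional.Properties using (∈-map⁺; ∈-map⁻; ∈-++⁺ˡ; ∈-++⁺ʳ; ∈-++⁻)
open import Data.List.Relation.Unary.All as All using ()
open import Data.List.Relation.Unary.AllPairs using ([]; _∷_)
open import Data.List.Relation.Unary.Any using (here; there)
open import Data.List.Relation.Unary.Any.Properties using (∷↔)
open import Data.List.Relation.Unary.Unique.Propositional using (Unique)
open import Data.List.Relation.Unary.Unique.Propositional.Properties as Unique using ()
open import Data.Nat
open import Data.Nat.Properties
open import Data.Nat.Tactic.RingSolver using (solve-∀)
open import Data.Product using (∃-syntax; _×_; _,_; proj₁; proj₂)
open import Data.Sum as Sum using (_⊎_; inj₁; inj₂)
open import Data.Vec using (Vec; []; _∷_; lookup; tabulate; replicate)
open import Data.Vec.Properties using (lookup∘tabulate; tabulate∘lookup; tabulate-cong; ∷-injectiveʳ)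
open import Function using (_∘_; id)
open import Function.Bundles using (_⇔_; mk⇔; Equivalence)
open import Function.Properties.Inverse using (↔⇒⇔)
open import Function.Properties.Equivalence using () renaming (trans to ⇔-trans; sym to ⇔-sym)
open import Relation.Binary.PropositionalEquality
open import Relation.Binary.Definitions using (Tri; tri<; tri≈; tri>)
open import Relation.Nullary using (¬_; yes; no)
open ≡-Reasoning

variable
  k m : ℕ

-- Unimodal permutations

placeLeft : (ℕ → ℕ) → ℕ → ℕ
placeLeft f zero = zero
placeLeft f (suc i) = suc (f i)

placeRight : ℕ → (ℕ → ℕ) → ℕ → ℕ
placeRight n f i with i ≟ n
... | yes _ = zero
... | no _ = suc (f i)

placeRight-here : ∀ n (f : ℕ → ℕ) → placeRight n f n ≡ zero
placeRight-here n f with n ≟ n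
... | yes _ = refl
... | no n≢n = ⊥-elim (n≢n refl)

placeRight-≢ : ∀ {n i} (f : ℕ → ℕ) → i ≢ n → placeRight n f i ≡ suc (f i)
placeRight-≢ {n} {i} f i≢n with i ≟ n
... | yes i≡n = ⊥-elim (i≢n i≡n)
... | no _ = refl

placeRight-< : ∀ {n i} (f : ℕ → ℕ) → i < n → placeRight n f i ≡ suc (f i)
placeRight-< f i<n = placeRight-≢ f (<⇒≢ i<n)

-- The permutation of {0,…,k} with code w: the first letter puts the value 0 at the left
-- end (true) or at the right end (false), the rest of the code arranges 1,…,k on the
-- remaining positions.
unimodal : Vec Bool k → ℕ → ℕ
unimodal [] _ = zero
unimodal (true ∷ w) = placeLeft (unimodal w)
unimodal {suc k} (false ∷ w) = placeRight (suc k) (unimodal w)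

unimodal-≤ : (w : Vec Bool k) {i : ℕ} → i ≤ k → unimodal w i ≤ k
unimodal-≤ [] _ = z≤n
unimodal-≤ (true ∷ w) {zero} _ = z≤n
unimodal-≤ (true ∷ w) {suc i} i≤k = s≤s (unimodal-≤ w (s≤s⁻¹ i≤k))
unimodal-≤ {suc k} (false ∷ w) {i} i≤k with i ≟ suc k
... | yes _ = z≤n
... | no i≢k = s≤s (unimodal-≤ w (s≤s⁻¹ (≤∧≢⇒< i≤k i≢k)))

unimodal-injective : (w : Vec Bool k) {i j : ℕ} → i ≤ k → j ≤ k →
                     unimodal w i ≡ unimodal w j → i ≡ j
unimodal-injective [] z≤n z≤n _ = refl
unimodal-injective (true ∷ w) {zero} {zero} _ _ _ = refl
unimodal-injective (true ∷ w) {suc i} {suc j} i≤k j≤k eq =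
  cong suc (unimodal-injective w (s≤s⁻¹ i≤k) (s≤s⁻¹ j≤k) (suc-injective eq))
unimodal-injective {suc k} (false ∷ w) {i} {j} i≤k j≤k eq with i ≟ suc k | j ≟ suc k
... | yes refl | yes refl = refl
... | no i≢k | no j≢k =
  unimodal-injective w (s≤s⁻¹ (≤∧≢⇒< i≤k i≢k)) (s≤s⁻¹ (≤∧≢⇒< j≤k j≢k)) (suc-injective eq)

peak : Vec Bool k → ℕ
peak [] = zero
peak (true ∷ w) = suc (peak w)
peak (false ∷ w) = peak w

peak≤ : (w : Vec Bool k) → peak w ≤ k
peak≤ [] = z≤n
peak≤ (true ∷ w) = s≤s (peak≤ w)
peak≤ (false ∷ w) = m≤n⇒m≤1+n (peak≤ w)

unimodal-peak : (w : Vec Bool k) → unimodal w (peak w) ≡ k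
unimodal-peak [] = refl
unimodal-peak (true ∷ w) = cong suc (unimodal-peak w)
unimodal-peak (false ∷ w) =
  trans (placeRight-< (unimodal w) (s≤s (peak≤ w))) (cong suc (unimodal-peak w))

unimodal-increasing : (w : Vec Bool k) {i j : ℕ} → i < j → j ≤ peak w →
                      unimodal w i < unimodal w j
unimodal-increasing (true ∷ w) {zero} {suc j} _ _ = z<s
unimodal-increasing (true ∷ w) {suc i} {suc j} i<j j≤p =
  s<s (unimodal-increasing w (s<s⁻¹ i<j) (s≤s⁻¹ j≤p))
unimodal-increasing (false ∷ w) {i} {j} i<j j≤p
  rewrite placeRight-< (unimodal w) (s≤s (≤-trans (<⇒≤ i<j) (≤-trans j≤p (peak≤ w))))
        | placeRight-< (unimodal w) (s≤s (≤-trans j≤p (peak≤ w)))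
  = s<s (unimodal-increasing w i<j j≤p)

unimodal-decreasing : (w : Vec Bool k) {i j : ℕ} → peak w ≤ i → i < j → j ≤ k →
                      unimodal w j < unimodal w i
unimodal-decreasing [] _ i<j z≤n = ⊥-elim (n≮0 i<j)
unimodal-decreasing (true ∷ w) {suc i} {suc j} p≤i i<j j≤k =
  s<s (unimodal-decreasing w (s≤s⁻¹ p≤i) (s<s⁻¹ i<j) (s≤s⁻¹ j≤k))
unimodal-decreasing {suc k} (false ∷ w) {i} {j} p≤i i<j j≤k
  rewrite placeRight-< (unimodal w) (<-≤-trans i<j j≤k) with j ≟ suc k
... | yes _ = z<s
... | no j≢k = s<s (unimodal-decreasing w p≤i i<j (s≤s⁻¹ (≤∧≢⇒< j≤k j≢k)))

unimodal-monotone : (w : Vec Bool k) {i j : ℕ} → i ≤ j → j ≤ peak w →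
                    unimodal w i ≤ unimodal w j
unimodal-monotone w i≤j j≤p with m≤n⇒m<n∨m≡n i≤j
... | inj₁ i<j = <⇒≤ (unimodal-increasing w i<j j≤p)
... | inj₂ refl = ≤-refl

unimodal-antitone : (w : Vec Bool k) {i j : ℕ} → peak w ≤ i → i ≤ j → j ≤ k →
                    unimodal w j ≤ unimodal w i
unimodal-antitone w p≤i i≤j j≤k with m≤n⇒m<n∨m≡n i≤j
... | inj₁ i<j = <⇒≤ (unimodal-decreasing w p≤i i<j j≤k)
... | inj₂ refl = ≤-refl

unimodal-noDip : (w : Vec Bool k) {i j l : ℕ} → i < j → j < l → l ≤ k →
                 unimodal w j < unimodal w i → unimodal w j < unimodal w l → ⊥
unimodal-noDip w {i} {j} i<j j<l l≤k fj<fi fj<fl with j ≤? peak w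
... | yes j≤p = <-asym (unimodal-increasing w i<j j≤p) fj<fi
... | no j≰p = <-asym (unimodal-decreasing w (<⇒≤ (≰⇒> j≰p)) j<l l≤k) fj<fl

-- The final letter places k − 1, which therefore lands directly beside the peak.
finalLetter : Vec Bool (suc k) → Bool
finalLetter (b ∷ []) = b
finalLetter (_ ∷ c ∷ w) = finalLetter (c ∷ w)

-- Values below the last entry were all put at the left end, before the first right placement.
unimodal-belowLast : (w : Vec Bool k) {j : ℕ} → j ≤ k →
                     unimodal w j < unimodal w k → unimodal w j ≡ j
unimodal-belowLast [] _ ()
unimodal-belowLast (true ∷ w) {zero} _ _ = refl
unimodal-belowLast (true ∷ w) {suc j} j≤k fj<fk =
  cong suc (unimodal-belowLast w (s≤s⁻¹ j≤k) (s<s⁻¹ fj<fk))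
unimodal-belowLast {suc k} (false ∷ w) _ fj<fk
  rewrite placeRight-here (suc k) (unimodal w) = ⊥-elim (n≮0 fj<fk)

unimodal-betweenLastTwo : (w : Vec Bool (suc m)) → peak w < m → {j : ℕ} → j ≤ suc m →
                          unimodal w (suc m) < unimodal w j → unimodal w j < unimodal w m →
                          unimodal w j ≡ suc j
unimodal-betweenLastTwo (true ∷ c ∷ w) p<m {suc j} j≤k fk<fj fj<fm =
  cong suc (unimodal-betweenLastTwo (c ∷ w) (s<s⁻¹ p<m) (s≤s⁻¹ j≤k) (s<s⁻¹ fk<fj) (s<s⁻¹ fj<fm))
unimodal-betweenLastTwo {m} (false ∷ w) _ {j} j≤k fk<fj fj<fm
  rewrite placeRight-here (suc m) (unimodal w) with j ≟ suc m
... | yes refl = ⊥-elim (n≮0 fk<fj)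
... | no j≢k rewrite placeRight-< (unimodal w) (n<1+n m) =
  cong suc (unimodal-belowLast w (s≤s⁻¹ (≤∧≢⇒< j≤k j≢k)) (s<s⁻¹ fj<fm))

secondLargest-beforePeak : (w : Vec Bool (suc m)) → finalLetter w ≡ true →
                           ∃[ q ] peak w ≡ suc q × unimodal w q ≡ m
secondLargest-beforePeak (true ∷ []) _ = zero , refl , refl
secondLargest-beforePeak (true ∷ c ∷ w) final
  with q , p≡ , fq≡ ← secondLargest-beforePeak (c ∷ w) final = suc q , cong suc p≡ , cong suc fq≡
secondLargest-beforePeak {suc m} (false ∷ c ∷ w) final
  with q , p≡ , fq≡ ← secondLargest-beforePeak (c ∷ w) final =
  q , p≡ , trans (placeRight-< (unimodal (c ∷ w)) q<k) (cong suc fq≡)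
  where
  q<k : q < suc (suc m)
  q<k = s≤s (≤-trans (n≤1+n q) (subst (_≤ suc m) p≡ (peak≤ (c ∷ w))))

secondLargest-afterPeak : (w : Vec Bool (suc m)) → finalLetter w ≡ false →
                          peak w ≤ m × unimodal w (suc (peak w)) ≡ m
secondLargest-afterPeak (false ∷ []) _ = z≤n , placeRight-here 1 (unimodal [])
secondLargest-afterPeak (true ∷ c ∷ w) final
  with p≤m , fp+1≡ ← secondLargest-afterPeak (c ∷ w) final = s≤s p≤m , cong suc fp+1≡
secondLargest-afterPeak (false ∷ c ∷ w) final
  with p≤m , fp+1≡ ← secondLargest-afterPeak (c ∷ w) final =
  m≤n⇒m≤1+n p≤m , trans (placeRight-< (unimodal (c ∷ w)) (s≤s (s≤s p≤m))) (cong suc fp+1≡)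

-- Valleys of the square

unimodal² : Vec Bool k → ℕ → ℕ
unimodal² w i = unimodal w (unimodal w i)

HasValley : Vec Bool k → Set
HasValley {k} w = ∃[ i ] suc (suc i) ≤ k ×
  unimodal² w (suc i) < unimodal² w i × unimodal² w i < unimodal² w (suc (suc i))

BadCode : Vec Bool (suc m) → Set
BadCode {m} w = peak w < m × finalLetter w ≡ true

GoodCode : Vec Bool (suc m) → Set
GoodCode {m} w = m ≤ peak w ⊎ finalLetter w ≡ false

-- Away from the peak π is monotone on i, i+1, i+2, and a valley of π² there is a dip of π.
valley-atPeak : (w : Vec Bool k) ((i , _) : HasValley w) → peak w ≡ suc i
valley-atPeak w (i , i+2≤k , g₁<g₀ , g₀<g₂) with suc (suc i) ≤? peak w | peak w ≤? i
... | yes i+2≤p | _ = ⊥-elim (unimodal-noDip w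
        (unimodal-increasing w (n<1+n i) (<⇒≤ i+2≤p)) (unimodal-increasing w (n<1+n (suc i)) i+2≤p)
        (unimodal-≤ w i+2≤k) g₁<g₀ (<-trans g₁<g₀ g₀<g₂))
... | no _ | yes p≤i = ⊥-elim (unimodal-noDip w
        (unimodal-decreasing w (m≤n⇒m≤1+n p≤i) (n<1+n (suc i)) i+2≤k)
        (unimodal-decreasing w p≤i (n<1+n i) (<⇒≤ i+2≤k))
        (unimodal-≤ w (≤-trans (n≤1+n i) (<⇒≤ i+2≤k))) (<-trans g₁<g₀ g₀<g₂) g₁<g₀)
... | no i+2≰p | no p≰i = ≤-antisym (s≤s⁻¹ (≰⇒> i+2≰p)) (≰⇒> p≰i)

unimodal²-≤ : (w : Vec Bool k) {i : ℕ} → i ≤ k → unimodal² w i ≤ k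
unimodal²-≤ w i≤k = unimodal-≤ w (unimodal-≤ w i≤k)

finalTrue-valley⇒peak<m : (w : Vec Bool (suc m)) → finalLetter w ≡ true → HasValley w → peak w < m
finalTrue-valley⇒peak<m {m} w final v@(i , i+2≤k , _ , g₀<g₂) with peak w <? m
... | yes p<m = p<m
... | no p≮m with q , p≡q+1 , fq≡m ← secondLargest-beforePeak w final =
  ⊥-elim (<⇒≱ g₀<g₂ (subst (unimodal² w (suc (suc i)) ≤_) (sym gᵢ≡k) (unimodal²-≤ w i+2≤k)))
  where
  p≡i+1 : peak w ≡ suc i
  p≡i+1 = valley-atPeak w v
  p≡m : peak w ≡ m
  p≡m = ≤-antisym (subst (_≤ m) (sym p≡i+1) (s≤s⁻¹ i+2≤k)) (≮⇒≥ p≮m)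
  gᵢ≡k : unimodal² w i ≡ suc m
  gᵢ≡k = begin
    unimodal w (unimodal w i) ≡⟨ cong (unimodal w ∘ unimodal w) (suc-injective (trans (sym p≡i+1) p≡q+1)) ⟩
    unimodal w (unimodal w q) ≡⟨ cong (unimodal w) (trans fq≡m (sym p≡m)) ⟩
    unimodal w (peak w)       ≡⟨ unimodal-peak w ⟩
    suc m                     ∎

finalFalse⇒noValley : (w : Vec Bool (suc m)) → finalLetter w ≡ false → ¬ HasValley w
finalFalse⇒noValley {m} w final v@(i , i+2≤k , g₁<g₀ , g₀<g₂)
  with p≤m , fp+1≡m ← secondLargest-afterPeak w final = dip (m≤n⇒m<n∨m≡n p≤m)
  where
  a : ℕ
  a = unimodal w i
  p≡i+1 : peak w ≡ suc i
  p≡i+1 = valley-atPeak w v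
  a≤k : a ≤ suc m
  a≤k = unimodal-≤ w (≤-trans (n≤1+n i) (<⇒≤ i+2≤k))
  fk<fa : unimodal w (suc m) < unimodal w a
  fk<fa = subst (_< unimodal w a)
            (cong (unimodal w) (trans (cong (unimodal w) (sym p≡i+1)) (unimodal-peak w))) g₁<g₀
  fa<fm : unimodal w a < unimodal w m
  fa<fm = subst (unimodal w a <_)
            (cong (unimodal w) (trans (cong (unimodal w ∘ suc) (sym p≡i+1)) fp+1≡m)) g₀<g₂
  dip : peak w < m ⊎ peak w ≡ m → ⊥
  dip (inj₂ p≡m) = ≤⇒≯ (s≤s⁻¹ (subst (unimodal w a <_) fm≡k fa<fm)) (subst (_< unimodal w a) fk≡m fk<fa)
    where
    fm≡k : unimodal w m ≡ suc m
    fm≡k = trans (cong (unimodal w) (sym p≡m)) (unimodal-peak w)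
    fk≡m : unimodal w (suc m) ≡ m
    fk≡m = subst (λ p → unimodal w (suc p) ≡ m) p≡m fp+1≡m
  dip (inj₁ p<m) with a <? peak w | a ≤? m
  ... | yes a<p | _ = <⇒≱ (≤-reflexive (sym fa≡a+1)) fa≤a
    where
    fa≡a+1 : unimodal w a ≡ suc a
    fa≡a+1 = unimodal-betweenLastTwo w p<m a≤k fk<fa fa<fm
    fa≤a : unimodal w a ≤ a
    fa≤a = unimodal-monotone w (s≤s⁻¹ (subst (a <_) p≡i+1 a<p)) (subst (i ≤_) (sym p≡i+1) (n≤1+n i))
  ... | no a≮p | yes a≤m = <⇒≱ fa<fm (unimodal-antitone w (≮⇒≥ a≮p) a≤m (n≤1+n m))
  ... | no _ | no a≰m = <-irrefl (cong (unimodal w) (≤-antisym (≰⇒> a≰m) a≤k)) fk<fa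

bad⇒valley : (w : Vec Bool (suc m)) → BadCode w → HasValley w
bad⇒valley {m} w (p<m , final) with q , p≡q+1 , fq≡m ← secondLargest-beforePeak w final =
  q , q+2≤k , subst₂ _<_ (sym g₁≡fk) (sym g₀≡fm) fk<fm , subst₂ _<_ (sym g₀≡fm) (sym g₂≡fb) fm<fb
  where
  p b : ℕ
  p = peak w
  b = unimodal w (suc p)
  q+2≤k : suc (suc q) ≤ suc m
  q+2≤k = m≤n⇒m≤1+n (subst (λ x → suc x ≤ m) p≡q+1 p<m)
  b≤k : b ≤ suc m
  b≤k = unimodal-≤ w (m≤n⇒m≤1+n p<m)
  g₀≡fm : unimodal² w q ≡ unimodal w m
  g₀≡fm = cong (unimodal w) fq≡m
  g₁≡fk : unimodal² w (suc q) ≡ unimodal w (suc m)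
  g₁≡fk = cong (unimodal w) (trans (cong (unimodal w) (sym p≡q+1)) (unimodal-peak w))
  g₂≡fb : unimodal² w (suc (suc q)) ≡ unimodal w b
  g₂≡fb = cong (unimodal w ∘ unimodal w ∘ suc) (sym p≡q+1)
  fk<fm : unimodal w (suc m) < unimodal w m
  fk<fm = unimodal-decreasing w (<⇒≤ p<m) (n<1+n m) ≤-refl
  fm≤b : unimodal w m ≤ b
  fm≤b = unimodal-antitone w (n≤1+n p) p<m (n≤1+n m)
  fm<fb : unimodal w m < unimodal w b
  fm<fb with <-cmp (unimodal w b) (unimodal w m)
  ... | tri> _ _ fm<fb = fm<fb
  ... | tri≈ _ fb≡fm _ = ⊥-elim (<⇒≢ (m<n⇒m<1+n (subst (q <_) (sym p≡q+1) (n<1+n q))) (sym p+1≡q))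
    where
    p+1≡q : suc p ≡ q
    p+1≡q = unimodal-injective w (m≤n⇒m≤1+n p<m) (≤-trans (n≤1+n q) (subst (_≤ suc m) p≡q+1 (peak≤ w)))
              (trans (unimodal-injective w b≤k (n≤1+n m) fb≡fm) (sym fq≡m))
  ... | tri< fb<fm _ _ with <-cmp (unimodal w b) (unimodal w (suc m))
  ...   | tri< fb<fk _ _ = ⊥-elim (<⇒≱ (<-trans fb<fk fk<fm)
                               (subst (unimodal w m ≤_) (sym (unimodal-belowLast w b≤k fb<fk)) fm≤b))
  ...   | tri≈ _ fb≡fk _ = ⊥-elim (1+n≢n (unimodal-injective w (m≤n⇒m≤1+n p<m) (peak≤ w)
                               (trans (unimodal-injective w b≤k ≤-refl fb≡fk) (sym (unimodal-peak w)))))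
  ...   | tri> _ _ fk<fb = ⊥-elim (<⇒≱ fb<fm
                               (subst (unimodal w m ≤_) (sym (unimodal-betweenLastTwo w p<m b≤k fk<fb fb<fm))
                                 (m≤n⇒m≤1+n fm≤b)))

valley⇒bad : (w : Vec Bool (suc m)) → HasValley w → BadCode w
valley⇒bad w v with finalLetter w in final
... | true = finalTrue-valley⇒peak<m w final v , refl
... | false = ⊥-elim (finalFalse⇒noValley w final v)

good⊎bad : (w : Vec Bool (suc m)) → GoodCode w ⊎ BadCode w
good⊎bad {m} w with m ≤? peak w | finalLetter w
... | yes m≤p | _ = inj₁ (inj₁ m≤p)
... | no _ | false = inj₁ (inj₂ refl)
... | no m≰p | true = inj₂ (≰⇒> m≰p , refl)

good⇒¬bad : (w : Vec Bool (suc m)) → GoodCode w → ¬ BadCode w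
good⇒¬bad w (inj₁ m≤p) (p<m , _) = <⇒≱ p<m m≤p
good⇒¬bad w (inj₂ final≡false) (_ , final≡true) with () ← trans (sym final≡false) final≡true

good⇔noValley : (w : Vec Bool (suc m)) → GoodCode w ⇔ (¬ HasValley w)
good⇔noValley w = mk⇔ (λ good v → good⇒¬bad w good (valley⇒bad w v)) noValley⇒good
  where
  noValley⇒good : ¬ HasValley w → GoodCode w
  noValley⇒good noValley with good⊎bad w
  ... | inj₁ good = good
  ... | inj₂ bad = ⊥-elim (noValley (bad⇒valley w bad))

-- Permutations avoiding 213 and 312

-- A dip is an entry smaller than some entry on each side of it; avoiding 213 and 312 means
-- having no dip.  Only the values of f below n matter.
record DipFreePerm (n : ℕ) (f : ℕ → ℕ) : Set where
  field
    bounded : ∀ {i} → i < n → f i < n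
    injective : ∀ {i j} → i < n → j < n → f i ≡ f j → i ≡ j
    surjective : ∀ {v} → v < n → ∃[ i ] i < n × f i ≡ v
    noDip : ∀ {i j l} → i < j → j < l → l < n → f j < f i → f j < f l → ⊥

suc-pred-≢0 : ∀ {x} → x ≢ 0 → suc (pred x) ≡ x
suc-pred-≢0 x≢0 = suc-pred _ {{≢-nonZero x≢0}}

strictMono⇒injective : (σ : ℕ → ℕ) → (∀ {i j} → i < j → σ i < σ j) →
                       ∀ {i j} → σ i ≡ σ j → i ≡ j
strictMono⇒injective σ σ-< {i} {j} σi≡σj with <-cmp i j
... | tri< i<j _ _ = ⊥-elim (<⇒≢ (σ-< i<j) σi≡σj)
... | tri≈ _ i≡j _ = i≡j
... | tri> _ _ j<i = ⊥-elim (<⇒≢ (σ-< j<i) (sym σi≡σj))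

-- σ enumerates, in increasing order, the positions where f is nonzero.
dropZero : ∀ {k f} → DipFreePerm (suc (suc k)) f → (σ : ℕ → ℕ) →
           (∀ {i j} → i < j → σ i < σ j) →
           (∀ {i} → i < suc k → σ i < suc (suc k)) →
           (∀ {i} → i < suc k → f (σ i) ≢ 0) →
           (∀ {x} → x < suc (suc k) → f x ≢ 0 → ∃[ i ] i < suc k × σ i ≡ x) →
           DipFreePerm (suc k) (pred ∘ f ∘ σ)
dropZero {k} {f} D σ σ-< σ-bounded σ-nonzero σ-covers = record
  { bounded = λ i<k → pred-mono-< {{≢-nonZero (σ-nonzero i<k)}} (bounded (σ-bounded i<k))
  ; injective = λ i<k j<k eq → strictMono⇒injective σ σ-<
      (injective (σ-bounded i<k) (σ-bounded j<k) (cancel-pred i<k j<k eq))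
  ; surjective = surjective′
  ; noDip = λ i<j j<l l<k fj<fi fj<fl → noDip (σ-< i<j) (σ-< j<l) (σ-bounded l<k)
      (pred-cancel-< fj<fi) (pred-cancel-< fj<fl)
  }
  where
  open DipFreePerm D
  cancel-pred : ∀ {i j} → i < suc k → j < suc k → pred (f (σ i)) ≡ pred (f (σ j)) → f (σ i) ≡ f (σ j)
  cancel-pred i<k j<k eq =
    trans (sym (suc-pred-≢0 (σ-nonzero i<k))) (trans (cong suc eq) (suc-pred-≢0 (σ-nonzero j<k)))
  surjective′ : ∀ {v} → v < suc k → ∃[ i ] i < suc k × pred (f (σ i)) ≡ v
  surjective′ {v} v<k with x , x<k , fx≡v+1 ← surjective (s<s v<k)
    with i , i<k , σi≡x ← σ-covers x<k (λ fx≡0 → 0≢1+n (trans (sym fx≡0) fx≡v+1)) =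
    i , i<k , cong pred (trans (cong f σi≡x) fx≡v+1)

-- Anywhere else the value 0 would be a dip.
zeroAtEnd : ∀ {k f} → DipFreePerm (suc (suc k)) f → f 0 ≡ 0 ⊎ f (suc k) ≡ 0
zeroAtEnd {k} {f} D = atEnd (surjective z<s)
  where
  open DipFreePerm D
  nonzero : ∀ {x z} → x < suc (suc k) → z < suc (suc k) → f z ≡ 0 → x ≢ z → 0 < f x
  nonzero x<n z<n fz≡0 x≢z = n≢0⇒n>0 (λ fx≡0 → x≢z (injective x<n z<n (trans fx≡0 (sym fz≡0))))
  atEnd : ∃[ z ] z < suc (suc k) × f z ≡ 0 → f 0 ≡ 0 ⊎ f (suc k) ≡ 0
  atEnd (zero , _ , f0≡0) = inj₁ f0≡0
  atEnd (suc j , j<n , fj≡0) with suc j ≟ suc k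
  ... | yes refl = inj₂ fj≡0
  ... | no j≢k = ⊥-elim (noDip z<s (≤∧≢⇒< (s≤s⁻¹ j<n) j≢k) (n<1+n (suc k))
          (subst (_< f 0) (sym fj≡0) (nonzero z<s j<n fj≡0 (λ ())))
          (subst (_< f (suc k)) (sym fj≡0) (nonzero (n<1+n (suc k)) j<n fj≡0 (j≢k ∘ sym))))

dipFree⇒unimodal : ∀ k {f} → DipFreePerm (suc k) f → ∃[ w ] (∀ {i} → i < suc k → f i ≡ unimodal {k} w i)
dipFree⇒unimodal zero D = [] , λ i<1 → n<1⇒n≡0 (DipFreePerm.bounded D i<1)
dipFree⇒unimodal (suc k) {f} D with zeroAtEnd D
... | inj₁ f0≡0 = true ∷ w , reconstruct
  where
  open DipFreePerm D
  nonzero : ∀ {i} → i < suc k → f (suc i) ≢ 0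
  nonzero i<k fi≡0 = 0≢1+n (injective z<s (s<s i<k) (trans f0≡0 (sym fi≡0)))
  covers : ∀ {x} → x < suc (suc k) → f x ≢ 0 → ∃[ i ] i < suc k × suc i ≡ x
  covers {zero} _ f0≢0 = ⊥-elim (f0≢0 f0≡0)
  covers {suc x} x<k _ = x , s<s⁻¹ x<k , refl
  IH : ∃[ w ] (∀ {i} → i < suc k → pred (f (suc i)) ≡ unimodal w i)
  IH = dipFree⇒unimodal k (dropZero D suc s<s s<s nonzero covers)
  w : Vec Bool k
  w = proj₁ IH
  reconstruct : ∀ {i} → i < suc (suc k) → f i ≡ unimodal (true ∷ w) i
  reconstruct {zero} _ = f0≡0
  reconstruct {suc i} i<k =
    trans (sym (suc-pred-≢0 (nonzero (s<s⁻¹ i<k)))) (cong suc (proj₂ IH (s<s⁻¹ i<k)))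
... | inj₂ fk≡0 = false ∷ w , reconstruct
  where
  open DipFreePerm D
  nonzero : ∀ {i} → i < suc k → f i ≢ 0
  nonzero i<k fi≡0 = <⇒≢ i<k (injective (m<n⇒m<1+n i<k) (n<1+n _) (trans fi≡0 (sym fk≡0)))
  covers : ∀ {x} → x < suc (suc k) → f x ≢ 0 → ∃[ i ] i < suc k × i ≡ x
  covers {x} x≤k fx≢0 = x , ≤∧≢⇒< (s≤s⁻¹ x≤k) (λ x≡k → fx≢0 (trans (cong f x≡k) fk≡0)) , refl
  IH : ∃[ w ] (∀ {i} → i < suc k → pred (f i) ≡ unimodal w i)
  IH = dipFree⇒unimodal k (dropZero D id id m<n⇒m<1+n nonzero covers)
  w : Vec Bool k
  w = proj₁ IH
  reconstruct : ∀ {i} → i < suc (suc k) → f i ≡ unimodal (false ∷ w) i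
  reconstruct {i} i≤k with i ≟ suc k
  ... | yes refl = fk≡0
  ... | no i≢k = trans (sym (suc-pred-≢0 (nonzero i<k))) (cong suc (proj₂ IH i<k))
    where
    i<k : i < suc k
    i<k = ≤∧≢⇒< (s≤s⁻¹ i≤k) i≢k

unimodalᶠ : Vec Bool k → Fin (suc k) → Fin (suc k)
unimodalᶠ w i = fromℕ< (s≤s (unimodal-≤ w (toℕ≤pred[n] i)))

toWord : Vec Bool k → Word (suc k)
toWord w = tabulate (unimodalᶠ w)

toℕ-unimodalᶠ : (w : Vec Bool k) (i : Fin (suc k)) → toℕ (unimodalᶠ w i) ≡ unimodal w (toℕ i)
toℕ-unimodalᶠ w i = toℕ-fromℕ< (s≤s (unimodal-≤ w (toℕ≤pred[n] i)))

lookup-toWord : (w : Vec Bool k) (i : Fin (suc k)) → toℕ (lookup (toWord w) i) ≡ unimodal w (toℕ i)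
lookup-toWord w i = trans (cong toℕ (lookup∘tabulate (unimodalᶠ w) i)) (toℕ-unimodalᶠ w i)

lookup-square-toWord : (w : Vec Bool k) (i : Fin (suc k)) →
                       toℕ (lookup (square (toWord w)) i) ≡ unimodal² w (toℕ i)
lookup-square-toWord w i = begin
  toℕ (lookup (square (toWord w)) i)
    ≡⟨ cong toℕ (lookup∘tabulate (lookup (toWord w) ∘ lookup (toWord w)) i) ⟩
  toℕ (lookup (toWord w) (lookup (toWord w) i)) ≡⟨ lookup-toWord w _ ⟩
  unimodal w (toℕ (lookup (toWord w) i))       ≡⟨ cong (unimodal w) (lookup-toWord w i) ⟩
  unimodal² w (toℕ i)                          ∎

unimodal-codeInjective : (w v : Vec Bool k) → (∀ {i} → i ≤ k → unimodal w i ≡ unimodal v i) → w ≡ v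
unimodal-codeInjective [] [] _ = refl
unimodal-codeInjective (true ∷ w) (true ∷ v) w≗v =
  cong (true ∷_) (unimodal-codeInjective w v (λ i≤k → suc-injective (w≗v (s≤s i≤k))))
unimodal-codeInjective {suc k} (false ∷ w) (false ∷ v) w≗v =
  cong (false ∷_) (unimodal-codeInjective w v λ {i} i≤k → suc-injective (begin
    suc (unimodal w i)                  ≡⟨ placeRight-< {suc k} (unimodal w) (s≤s i≤k) ⟨
    unimodal (false ∷ w) i              ≡⟨ w≗v (m≤n⇒m≤1+n i≤k) ⟩
    unimodal (false ∷ v) i              ≡⟨ placeRight-< {suc k} (unimodal v) (s≤s i≤k) ⟩
    suc (unimodal v i)                  ∎))
unimodal-codeInjective {suc k} (true ∷ w) (false ∷ v) w≗v =
  ⊥-elim (0≢1+n (trans (w≗v z≤n) (placeRight-< {suc k} (unimodal v) z<s)))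
unimodal-codeInjective {suc k} (false ∷ w) (true ∷ v) w≗v =
  ⊥-elim (0≢1+n (trans (sym (w≗v z≤n)) (placeRight-< {suc k} (unimodal w) z<s)))

toWord-injective : {w v : Vec Bool k} → toWord w ≡ toWord v → w ≡ v
toWord-injective {k} {w} {v} eq = unimodal-codeInjective w v λ {i} i≤k →
  let x = fromℕ< (s≤s i≤k) in begin
    unimodal w i                 ≡⟨ cong (unimodal w) (toℕ-fromℕ< (s≤s i≤k)) ⟨
    unimodal w (toℕ x)           ≡⟨ lookup-toWord w x ⟨
    toℕ (lookup (toWord w) x)    ≡⟨ cong (λ π → toℕ (lookup π x)) eq ⟩
    toℕ (lookup (toWord v) x)    ≡⟨ lookup-toWord v x ⟩
    unimodal v (toℕ x)           ≡⟨ cong (unimodal v) (toℕ-fromℕ< (s≤s i≤k)) ⟩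
    unimodal v i                 ∎

toWord-isPerm : (w : Vec Bool k) → IsPerm (toWord w)
toWord-isPerm w i j πi≡πj = toℕ-injective (unimodal-injective w (toℕ≤pred[n] i) (toℕ≤pred[n] j)
  (trans (sym (lookup-toWord w i)) (trans (cong toℕ πi≡πj) (lookup-toWord w j))))

toWord-noDip : (w : Vec Bool k) {i j l : Fin (suc k)} → i <ᶠ j → j <ᶠ l →
               lookup (toWord w) j <ᶠ lookup (toWord w) i → lookup (toWord w) j <ᶠ lookup (toWord w) l → ⊥
toWord-noDip w {i} {j} {l} i<j j<l πj<πi πj<πl = unimodal-noDip w i<j j<l (toℕ≤pred[n] l)
  (subst₂ _<_ (lookup-toWord w j) (lookup-toWord w i) πj<πi)
  (subst₂ _<_ (lookup-toWord w j) (lookup-toWord w l) πj<πl)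

toWord-avoids213 : (w : Vec Bool k) → ¬ Contains213 (toWord w)
toWord-avoids213 w (i , j , l , i<j , j<l , πj<πi , πi<πl) = toWord-noDip w i<j j<l πj<πi (<-trans πj<πi πi<πl)

toWord-avoids312 : (w : Vec Bool k) → ¬ Contains312 (toWord w)
toWord-avoids312 w (i , j , l , i<j , j<l , πj<πl , πl<πi) = toWord-noDip w i<j j<l (<-trans πj<πl πl<πi) πj<πl

consec⇒valley : (w : Vec Bool k) → ContainsConsec213 (square (toWord w)) → HasValley w
consec⇒valley w (i , j , l , j≡i+1 , l≡j+1 , σj<σi , σi<σl) =
  toℕ i , subst (_≤ _) l≡i+2 (toℕ≤pred[n] l) ,
  subst₂ _<_ (value j≡i+1) (value refl) σj<σi , subst₂ _<_ (value refl) (value l≡i+2) σi<σl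
  where
  l≡i+2 : toℕ l ≡ suc (suc (toℕ i))
  l≡i+2 = trans l≡j+1 (cong suc j≡i+1)
  value : ∀ {x n} → toℕ x ≡ n → toℕ (lookup (square (toWord w)) x) ≡ unimodal² w n
  value {x} x≡n = trans (lookup-square-toWord w x) (cong (unimodal² w) x≡n)

valley⇒consec : (w : Vec Bool k) → HasValley w → ContainsConsec213 (square (toWord w))
valley⇒consec {k} w (i , i+2≤k , g₁<g₀ , g₀<g₂) =
  position i≤k , position i+1≤k , position i+2≤k ,
  trans (toℕ-fromℕ< (s≤s i+1≤k)) (cong suc (sym (toℕ-fromℕ< (s≤s i≤k)))) ,
  trans (toℕ-fromℕ< (s≤s i+2≤k)) (cong suc (sym (toℕ-fromℕ< (s≤s i+1≤k)))) ,
  subst₂ _<_ (sym (value i+1≤k)) (sym (value i≤k)) g₁<g₀ ,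
  subst₂ _<_ (sym (value i≤k)) (sym (value i+2≤k)) g₀<g₂
  where
  i+1≤k : suc i ≤ k
  i+1≤k = ≤-trans (n≤1+n _) i+2≤k
  i≤k : i ≤ k
  i≤k = ≤-trans (n≤1+n _) i+1≤k
  position : ∀ {x} → x ≤ k → Fin (suc k)
  position x≤k = fromℕ< (s≤s x≤k)
  value : ∀ {x} (x≤k : x ≤ k) → toℕ (lookup (square (toWord w)) (position x≤k)) ≡ unimodal² w x
  value x≤k = trans (lookup-square-toWord w _) (cong (unimodal² w) (toℕ-fromℕ< (s≤s x≤k)))

good⇔goodCode : (w : Vec Bool (suc m)) → Good (toWord w) ⇔ GoodCode w
good⇔goodCode w = mk⇔
  (λ (_ , _ , _ , noConsec) → Equivalence.from (good⇔noValley w) (noConsec ∘ valley⇒consec w))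
  (λ good → toWord-isPerm w , toWord-avoids213 w , toWord-avoids312 w ,
            Equivalence.to (good⇔noValley w) good ∘ consec⇒valley w)

injective⇒surjective : ∀ {n} (f : Fin n → Fin n) → (∀ i j → f i ≡ f j → i ≡ j) →
                       ∀ v → ∃[ x ] f x ≡ v
injective⇒surjective {suc n} f f-inj v with any? (λ x → f x ≟ᶠ v)
... | yes hit = hit
... | no miss = ⊥-elim (<-irrefl refl (injective⇒≤ {f = punched} punched-injective))
  where
  punched : Fin (suc n) → Fin n
  punched x = punchOut {i = v} {j = f x} (λ v≡fx → miss (x , sym v≡fx))
  punched-injective : ∀ {x y} → punched x ≡ punched y → x ≡ y
  punched-injective {x} {y} eq =
    f-inj x y (punchOut-injective (λ v≡fx → miss (x , sym v≡fx)) (λ v≡fy → miss (y , sym v≡fy)) eq)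

asFunction : ∀ {n} → Word n → ℕ → ℕ
asFunction {n} π i with i <? n
... | yes i<n = toℕ (lookup π (fromℕ< i<n))
... | no _ = 0

asFunction-< : ∀ {n i} (π : Word n) (i<n : i < n) → asFunction π i ≡ toℕ (lookup π (fromℕ< i<n))
asFunction-< {n} {i} π i<n with i <? n
... | yes _ = refl
... | no i≮n = ⊥-elim (i≮n i<n)

asFunction-toℕ : ∀ {n} (π : Word n) (x : Fin n) → asFunction π (toℕ x) ≡ toℕ (lookup π x)
asFunction-toℕ π x = trans (asFunction-< π (toℕ<n x)) (cong (toℕ ∘ lookup π) (fromℕ<-toℕ x (toℕ<n x)))

avoiding⇒dipFree : ∀ {n} (π : Word n) → IsPerm π → ¬ Contains213 π → ¬ Contains312 π →
                   DipFreePerm n (asFunction π)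
avoiding⇒dipFree {n} π isPerm no213 no312 = record
  { bounded = λ i<n → subst (_< n) (sym (asFunction-< π i<n)) (toℕ<n _)
  ; injective = injective
  ; surjective = surjective
  ; noDip = noDip
  }
  where
  position-< : ∀ {i j} (i<n : i < n) (j<n : j < n) → i < j → fromℕ< i<n <ᶠ fromℕ< j<n
  position-< i<n j<n = subst₂ _<_ (sym (toℕ-fromℕ< i<n)) (sym (toℕ-fromℕ< j<n))
  value-< : ∀ {i j} (i<n : i < n) (j<n : j < n) → asFunction π i < asFunction π j →
            lookup π (fromℕ< i<n) <ᶠ lookup π (fromℕ< j<n)
  value-< i<n j<n = subst₂ _<_ (asFunction-< π i<n) (asFunction-< π j<n)
  injective : ∀ {i j} → i < n → j < n → asFunction π i ≡ asFunction π j → i ≡ j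
  injective {i} {j} i<n j<n eq = begin
    i                  ≡⟨ toℕ-fromℕ< i<n ⟨
    toℕ (fromℕ< i<n)   ≡⟨ cong toℕ (isPerm _ _ (toℕ-injective
                            (trans (sym (asFunction-< π i<n)) (trans eq (asFunction-< π j<n))))) ⟩
    toℕ (fromℕ< j<n)   ≡⟨ toℕ-fromℕ< j<n ⟩
    j                  ∎
  surjective : ∀ {v} → v < n → ∃[ i ] i < n × asFunction π i ≡ v
  surjective v<n with x , πx≡v ← injective⇒surjective (lookup π) isPerm (fromℕ< v<n) =
    toℕ x , toℕ<n x , trans (asFunction-toℕ π x) (trans (cong toℕ πx≡v) (toℕ-fromℕ< v<n))
  noDip : ∀ {i j l} → i < j → j < l → l < n →
          asFunction π j < asFunction π i → asFunction π j < asFunction π l → ⊥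
  noDip {i} {j} {l} i<j j<l l<n fj<fi fj<fl = byValue (<-cmp (asFunction π i) (asFunction π l))
    where
    j<n : j < n
    j<n = <-trans j<l l<n
    i<n : i < n
    i<n = <-trans i<j j<n
    byValue : Tri (asFunction π i < asFunction π l) (asFunction π i ≡ asFunction π l)
                  (asFunction π l < asFunction π i) → ⊥
    byValue (tri< fi<fl _ _) = no213 (fromℕ< i<n , fromℕ< j<n , fromℕ< l<n ,
      position-< i<n j<n i<j , position-< j<n l<n j<l , value-< j<n i<n fj<fi , value-< i<n l<n fi<fl)
    byValue (tri≈ _ fi≡fl _) = <-irrefl (injective i<n l<n fi≡fl) (<-trans i<j j<l)
    byValue (tri> _ _ fl<fi) = no312 (fromℕ< i<n , fromℕ< j<n , fromℕ< l<n ,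
      position-< i<n j<n i<j , position-< j<n l<n j<l , value-< j<n l<n fj<fl , value-< l<n i<n fl<fi)

avoiding⇒toWord : (π : Word (suc k)) → IsPerm π → ¬ Contains213 π → ¬ Contains312 π → ∃[ w ] π ≡ toWord w
avoiding⇒toWord {k} π isPerm no213 no312
  with w , π≗w ← dipFree⇒unimodal k (avoiding⇒dipFree π isPerm no213 no312) =
  w , trans (sym (tabulate∘lookup π)) (tabulate-cong λ x → toℕ-injective (begin
    toℕ (lookup π x)         ≡⟨ asFunction-toℕ π x ⟨
    asFunction π (toℕ x)     ≡⟨ π≗w (toℕ<n x) ⟩
    unimodal w (toℕ x)       ≡⟨ toℕ-unimodalᶠ w x ⟨
    toℕ (unimodalᶠ w x)      ∎))

-- Counting the good codes

branch : List (Vec Bool k) → List (Vec Bool k) → List (Vec Bool (suc k))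
branch xs ys = map (true ∷_) xs ++ map (false ∷_) ys

∈-branch-true : ∀ {xs ys : List (Vec Bool k)} {x} → (true ∷ x) ∈ branch xs ys ⇔ x ∈ xs
∈-branch-true {xs = xs} = mk⇔ from-branch (∈-++⁺ˡ ∘ ∈-map⁺ (true ∷_))
  where
  from-branch : ∀ {ys x} → (true ∷ x) ∈ branch xs ys → x ∈ xs
  from-branch x∈ with ∈-++⁻ (map (true ∷_) xs) x∈
  ... | inj₁ x∈xs with y , y∈xs , eq ← ∈-map⁻ (true ∷_) x∈xs = subst (_∈ xs) (sym (∷-injectiveʳ eq)) y∈xs
  ... | inj₂ x∈ys with _ , _ , () ← ∈-map⁻ (false ∷_) x∈ys

∈-branch-false : ∀ {xs ys : List (Vec Bool k)} {x} → (false ∷ x) ∈ branch xs ys ⇔ x ∈ ys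
∈-branch-false {xs = xs} {ys} = mk⇔ from-branch (∈-++⁺ʳ (map (true ∷_) xs) ∘ ∈-map⁺ (false ∷_))
  where
  from-branch : ∀ {x} → (false ∷ x) ∈ branch xs ys → x ∈ ys
  from-branch x∈ with ∈-++⁻ (map (true ∷_) xs) x∈
  ... | inj₁ x∈xs with _ , _ , () ← ∈-map⁻ (true ∷_) x∈xs
  ... | inj₂ x∈ys with y , y∈ys , eq ← ∈-map⁻ (false ∷_) x∈ys = subst (_∈ ys) (sym (∷-injectiveʳ eq)) y∈ys

branch-unique : {xs ys : List (Vec Bool k)} → Unique xs → Unique ys → Unique (branch xs ys)
branch-unique {xs = xs} {ys} xs! ys! =
  Unique.++⁺ (Unique.map⁺ ∷-injectiveʳ xs!) (Unique.map⁺ ∷-injectiveʳ ys!) disjoint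
  where
  disjoint : ∀ {v} → ¬ (v ∈ map (true ∷_) xs × v ∈ map (false ∷_) ys)
  disjoint (v∈xs , v∈ys) with _ , _ , refl ← ∈-map⁻ (true ∷_) v∈xs
    with _ , _ , () ← ∈-map⁻ (false ∷_) v∈ys

length-branch : (xs ys : List (Vec Bool k)) → length (branch xs ys) ≡ length xs + length ys
length-branch xs ys =
  trans (length-++ (map (true ∷_) xs)) (cong₂ _+_ (length-map (true ∷_) xs) (length-map (false ∷_) ys))

finalFalseCodes : ∀ m → List (Vec Bool (suc m))
finalFalseCodes zero = (false ∷ []) ∷ []
finalFalseCodes (suc m) = branch (finalFalseCodes m) (finalFalseCodes m)

∈-finalFalseCodes : (w : Vec Bool (suc m)) → w ∈ finalFalseCodes m ⇔ finalLetter w ≡ false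
∈-finalFalseCodes (false ∷ []) = mk⇔ (λ _ → refl) (λ _ → here refl)
∈-finalFalseCodes (true ∷ []) = mk⇔ (λ { (here ()) ; (there ()) }) (λ ())
∈-finalFalseCodes (true ∷ c ∷ w) = ⇔-trans ∈-branch-true (∈-finalFalseCodes (c ∷ w))
∈-finalFalseCodes (false ∷ c ∷ w) = ⇔-trans ∈-branch-false (∈-finalFalseCodes (c ∷ w))

finalFalseCodes-unique : ∀ m → Unique (finalFalseCodes m)
finalFalseCodes-unique zero = All.[] ∷ []
finalFalseCodes-unique (suc m) = branch-unique (finalFalseCodes-unique m) (finalFalseCodes-unique m)

length-finalFalseCodes : ∀ m → length (finalFalseCodes m) ≡ 2 ^ m
length-finalFalseCodes zero = refl
length-finalFalseCodes (suc m) = begin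
  length (branch (finalFalseCodes m) (finalFalseCodes m)) ≡⟨ length-branch (finalFalseCodes m) (finalFalseCodes m) ⟩
  length (finalFalseCodes m) + length (finalFalseCodes m)
    ≡⟨ cong₂ _+_ (length-finalFalseCodes m) (length-finalFalseCodes m) ⟩
  2 ^ m + 2 ^ m                                           ≡⟨ cong (2 ^ m +_) (+-identityʳ (2 ^ m)) ⟨
  2 ^ suc m                                               ∎

finalLetter-allTrue : ∀ m → finalLetter (replicate (suc m) true) ≡ true
finalLetter-allTrue zero = refl
finalLetter-allTrue (suc m) = finalLetter-allTrue m

peak-allTrue : ∀ k → peak (replicate k true) ≡ k
peak-allTrue zero = refl
peak-allTrue (suc k) = cong suc (peak-allTrue k)

peak≥length⇔allTrue : (w : Vec Bool k) → k ≤ peak w ⇔ w ≡ replicate k true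
peak≥length⇔allTrue {k} w = mk⇔ (allTrue w) (λ { refl → ≤-reflexive (sym (peak-allTrue k)) })
  where
  allTrue : ∀ {k} (w : Vec Bool k) → k ≤ peak w → w ≡ replicate k true
  allTrue [] _ = refl
  allTrue (true ∷ w) k≤p = cong (true ∷_) (allTrue w (s≤s⁻¹ k≤p))
  allTrue (false ∷ w) k≤p = ⊥-elim (<⇒≱ k≤p (peak≤ w))

goodCodes : ∀ m → List (Vec Bool (suc m))
goodCodes zero = (true ∷ []) ∷ (false ∷ []) ∷ []
goodCodes (suc m) = branch (goodCodes m) (replicate (suc m) true ∷ finalFalseCodes m)

good-true⇔ : (w : Vec Bool (suc m)) → GoodCode (true ∷ w) ⇔ GoodCode w
good-true⇔ (_ ∷ _) = mk⇔ (Sum.map₁ s≤s⁻¹) (Sum.map₁ s≤s)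

good-false⇔ : (w : Vec Bool (suc m)) →
              GoodCode (false ∷ w) ⇔ (w ≡ replicate (suc m) true ⊎ w ∈ finalFalseCodes m)
good-false⇔ w@(_ ∷ _) = mk⇔
  (Sum.map (Equivalence.to (peak≥length⇔allTrue w)) (Equivalence.from (∈-finalFalseCodes w)))
  (Sum.map (Equivalence.from (peak≥length⇔allTrue w)) (Equivalence.to (∈-finalFalseCodes w)))

∈-goodCodes : (w : Vec Bool (suc m)) → w ∈ goodCodes m ⇔ GoodCode w
∈-goodCodes {zero} (true ∷ []) = mk⇔ (λ _ → inj₁ z≤n) (λ _ → here refl)
∈-goodCodes {zero} (false ∷ []) = mk⇔ (λ _ → inj₁ z≤n) (λ _ → there (here refl))
∈-goodCodes {suc m} (true ∷ w) = ⇔-trans ∈-branch-true (⇔-trans (∈-goodCodes w) (⇔-sym (good-true⇔ w)))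
∈-goodCodes {suc m} (false ∷ w) = ⇔-trans ∈-branch-false (⇔-trans (⇔-sym (↔⇒⇔ (∷↔ (w ≡_)))) (⇔-sym (good-false⇔ w)))

goodCodes-unique : ∀ m → Unique (goodCodes m)
goodCodes-unique zero = ((λ ()) All.∷ All.[]) ∷ All.[] ∷ []
goodCodes-unique (suc m) =
  branch-unique (goodCodes-unique m) (All.tabulate allTrue≢ ∷ finalFalseCodes-unique m)
  where
  allTrue≢ : ∀ {w} → w ∈ finalFalseCodes m → replicate (suc m) true ≢ w
  allTrue≢ {w} w∈ refl with () ← trans (sym (finalLetter-allTrue m)) (Equivalence.to (∈-finalFalseCodes w) w∈)

length-goodCodes : ∀ m → length (goodCodes m) ≡ 2 ^ m + suc m
length-goodCodes zero = refl
length-goodCodes (suc m) = begin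
  length (goodCodes (suc m))                              ≡⟨ length-branch (goodCodes m) _ ⟩
  length (goodCodes m) + suc (length (finalFalseCodes m))
    ≡⟨ cong₂ (λ a b → a + suc b) (length-goodCodes m) (length-finalFalseCodes m) ⟩
  2 ^ m + suc m + suc (2 ^ m)                             ≡⟨ regroup (2 ^ m) m ⟩
  2 ^ suc m + suc (suc m)                                 ∎
  where
  regroup : ∀ x m → x + suc m + suc x ≡ 2 * x + suc (suc m)
  regroup = solve-∀

mainTheorem2 : (n : ℕ) → 2 ≤ n →
    HasCount {n} Good (2 ^ (n ∸ 2) + (n ∸ 1))
mainTheorem2 (suc zero) (s≤s ())
mainTheorem2 (suc (suc m)) _ =
  map toWord (goodCodes m) ,
  Unique.map⁺ toWord-injective (goodCodes-unique m) ,
  (λ π → mk⇔ (image⇒good π) (good⇒image π)) ,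
  trans (length-map toWord (goodCodes m)) (length-goodCodes m)
  where
  image⇒good : (π : Word (suc (suc m))) → π ∈ map toWord (goodCodes m) → Good π
  image⇒good π π∈ with w , w∈ , refl ← ∈-map⁻ toWord π∈ =
    Equivalence.from (good⇔goodCode w) (Equivalence.to (∈-goodCodes w) w∈)
  good⇒image : (π : Word (suc (suc m))) → Good π → π ∈ map toWord (goodCodes m)
  good⇒image π good@(isPerm , no213 , no312 , _) with w , refl ← avoiding⇒toWord π isPerm no213 no312 =
    ∈-map⁺ toWord (Equivalence.from (∈-goodCodes w) (Equivalence.to (good⇔goodCode w) good))
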